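{- Let $\mathcal C\subseteq\mathbb F_2^n$ be a binary linear code, $K$ a field, $<$ a total-degree compatible term order on $[X]$ with $x_1<\dots<x_n$, and $G_T$ the reduced Gröbner basis of $I(\mathcal C)$ with respect to $<$. Let $g\in G_T\setminus\{x_i^2-1: i=1,\dots,n\}$ with $\mathrm{weight}(c_g)=d'$, and let $t'=\left[\frac{d'-1}{2}\right]+1$. Then $\mathrm{Td}(g)=t'$ or $\mathrm{Td}(g)=t'+1$.
   Context: A binary linear code is an $\mathbb F_2$-subspace of $\mathbb F_2^n$; weight is Hamming weight and $[\cdot]$ is the integer part. $[X]$ is the free commutative monoid on $X=\{x_1,\dots,x_n\}$ (monomials of $K[x_1,\dots,x_n]$); $\psi:[X]\to\mathbb F_2^n$ is $\psi(\prod_i x_i^{\beta_i})=(\beta_1\bmod 2,\dots,\beta_n\bmod 2)$. $I(\mathcal C)=\langle w-v: w,v\in[X],\ \psi(w)-\psi(v)\in\mathcal C\rangle$ (it contains all $x_i^2-1$). For a binomial $g=w-v\in I(\mathcal C)$, $c_g=\psi(w)+\psi(v)$. $\mathrm{Td}(f)$ denotes the total degree of the leading term of $f$ w.r.t. $<$. -}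

module Defs where

open import Level using (Level; _⊔_; suc; 0ℓ)
open import Algebra.Bundles using (CommutativeRing)
open import Data.Bool using (Bool; true; false; _xor_; if_then_else_)
open import Data.Nat as ℕ using (ℕ; zero)
open import Data.Fin using (Fin)
import Data.Fin as Fin
open import Data.Vec using (Vec; []; _∷_; zipWith; map; replicate; lookup; updateAt; tabulate)
open import Data.Vec.Properties using (≡-dec)
open import Data.List using (List; []; _∷_; _++_; concatMap; foldr; length)
import Data.List as List
open import Data.List.Relation.Unary.All using (All)
open import Data.Product using (Σ; ∃; ∃₂; _×_; _,_; proj₁; proj₂)
open import Data.Sum using (_⊎_)
open import Relation.Nullary.Decidable using (⌊_⌋)
open import Relation.Binary.PropositionalEquality using (_≡_; _≢_)
open import Relation.Binary.Definitions using (DecidableEquality)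
open import Relation.Binary.Core using (Rel)
open import Relation.Binary.Structures using (IsStrictTotalOrder)
open import Relation.Nullary using (¬_; yes; no)

record Field (c ℓ : Level) : Set (suc (c ⊔ ℓ)) where
  field
    commutativeRing : CommutativeRing c ℓ
  open CommutativeRing commutativeRing public
  field
    1≉0     : ¬ (1# ≈ 0#)
    inverse : ∀ x → ¬ (x ≈ 0#) → ∃ λ y → (x * y) ≈ 1#

Word : ℕ → Set
Word n = Vec Bool n

_⊕ʷ_ : ∀ {n} → Word n → Word n → Word n
_⊕ʷ_ = zipWith _xor_

weight : ∀ {n} → Word n → ℕ
weight []           = 0
weight (true  ∷ xs) = 1 ℕ.+ weight xs
weight (false ∷ xs) = weight xs

-- A binary linear code: an 𝔽₂-subspace of 𝔽₂ⁿ (over 𝔽₂ this means: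
-- contains 0 and is closed under addition).
record IsBinaryLinearCode {n : ℕ} (C : Word n → Set) : Set where
  field
    zero∈ : C (replicate n false)
    +-closed : ∀ {a b} → C a → C b → C (a ⊕ʷ b)

Monomial : ℕ → Set
Monomial n = Vec ℕ n

_≟ₘ_ : ∀ {n} → DecidableEquality (Monomial n)
_≟ₘ_ = ≡-dec ℕ._≟_

oneₘ : ∀ {n} → Monomial n
oneₘ {n} = replicate n 0

_·ₘ_ : ∀ {n} → Monomial n → Monomial n → Monomial n
_·ₘ_ = zipWith ℕ._+_

var : ∀ {n} → Fin n → Monomial n
var {n} i = updateAt (replicate n 0) i (λ _ → 1)

deg : ∀ {n} → Monomial n → ℕ
deg []       = 0
deg (a ∷ as) = a ℕ.+ deg as

_∣ₘ_ : ∀ {n} → Monomial n → Monomial n → Set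
a ∣ₘ b = ∃ λ c → (a ·ₘ c) ≡ b

parity : ℕ → Bool
parity zero          = false
parity (ℕ.suc zero)  = true
parity (ℕ.suc (ℕ.suc k)) = parity k

ψ : ∀ {n} → Monomial n → Word n
ψ = map parity

record IsTermOrder {n : ℕ} (_<_ : Rel (Monomial n) 0ℓ) : Set where
  field
    strictTotal    : IsStrictTotalOrder _≡_ _<_
    one-least      : ∀ m → m ≢ oneₘ → oneₘ < m
    multiplicative : ∀ a b c → a < b → (a ·ₘ c) < (b ·ₘ c)

IsDegCompatible : ∀ {n} → Rel (Monomial n) 0ℓ → Set
IsDegCompatible _<_ = ∀ a b → deg a ℕ.< deg b → a < b

-- t' = [(d'-1)/2] + 1  (integer part = floor; for d' = 0 this is 0)

tPrime : ℕ → ℕ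
tPrime zero    = 0
tPrime (ℕ.suc k) = k ℕ./ 2 ℕ.+ 1

-- Polynomials K[x₁,…,xₙ] over a field, as finite formal sums of terms;
-- two polynomials are equal when all their coefficients agree.

module Polynomials {c ℓ : Level} (F : Field c ℓ) (n : ℕ) where
  open Field F

  Poly : Set c
  Poly = List (Carrier × Monomial n)

  coeff : Poly → Monomial n → Carrier
  coeff []             m = 0#
  coeff ((a , m') ∷ p) m = if ⌊ m' ≟ₘ m ⌋ then a + coeff p m else coeff p m

  _≈ₚ_ : Poly → Poly → Set ℓ
  p ≈ₚ q = ∀ m → coeff p m ≈ coeff q m

  InSupp : Poly → Monomial n → Set ℓ
  InSupp p m = ¬ (coeff p m ≈ 0#)

  IsLM : Rel (Monomial n) 0ℓ → Poly → Monomial n → Set ℓ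
  IsLM _<_ p m = InSupp p m × (∀ m' → InSupp p m' → m' ≡ m ⊎ m' < m)

  scaleMon : Carrier → Monomial n → Poly → Poly
  scaleMon a m = List.map (λ t → (a * proj₁ t , m ·ₘ proj₂ t))

  binom : Monomial n → Monomial n → Poly
  binom w v = (1# , w) ∷ (- 1# , v) ∷ []

  -- f ∈ ⟨S⟩: f = Σ_j h_j s_j with s_j ∈ S, where the h_j are expanded
  -- into terms a·m.
  InIdeal : (Poly → Set (c ⊔ ℓ)) → Poly → Set (c ⊔ ℓ)
  InIdeal S f = ∃ λ (ts : List (Carrier × Monomial n × Poly)) →
    All (λ t → S (proj₂ (proj₂ t))) ts ×
    (f ≈ₚ concatMap (λ t → scaleMon (proj₁ t) (proj₁ (proj₂ t)) (proj₂ (proj₂ t))) ts)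

  -- generators w - v of I(C): ψ(w) - ψ(v) ∈ C (over 𝔽₂, minus = plus)
  CodeGen : (Word n → Set) → Poly → Set (c ⊔ ℓ)
  CodeGen C p = Level.Lift (c ⊔ ℓ) (∃₂ λ w v → C (ψ w ⊕ʷ ψ v) × p ≡ binom w v)

  I[_] : (Word n → Set) → Poly → Set (c ⊔ ℓ)
  I[ C ] = InIdeal (CodeGen C)

  record IsReducedGB (_<_ : Rel (Monomial n) 0ℓ) (I : Poly → Set (c ⊔ ℓ))
                     (G : List Poly) : Set (c ⊔ ℓ) where
    field
      ⊆I       : All I G
      nonzero  : ∀ i → ∃ λ m → IsLM _<_ (List.lookup G i) m
      groebner : ∀ f m → I f → IsLM _<_ f m →
                 ∃ λ i → ∃ λ mg → IsLM _<_ (List.lookup G i) mg × (mg ∣ₘ m)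
      monic    : ∀ i m → IsLM _<_ (List.lookup G i) m → coeff (List.lookup G i) m ≈ 1#
      reduced  : ∀ i j → i ≢ j → ∀ m → InSupp (List.lookup G i) m →
                 ∀ mj → IsLM _<_ (List.lookup G j) mj → ¬ (mj ∣ₘ m)

module Submission where

-- Write gᵢ = m − v with m its leading monomial (if the other monomial led, monicity would force
-- −1 = 1, so the two can be swapped). As gᵢ is reduced, no binomial of I(C) has a leading monomial
-- properly dividing m. Because every xₖ² − 1 lies in I(C), a variable common to m and v could be
-- cancelled from m − v, and once deg m ≥ deg v + 3 a variable of m could be moved over to v; both
-- would produce such a binomial. Similarly xⱼ² ∤ v (otherwise m ∣ xⱼ² ∣ v) and xₖ² ∣ m only when
-- m = xₖ². So m and v have disjoint supports and v is square-free, whence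
-- d′ = wt(ψ m) + deg v; together with deg v ≤ deg m ≤ deg v + 2 this squeezes deg m between
-- ⌈d′/2⌉ = t′ and t′ + 1.

open import Defs
open import Level using (Level; _⊔_; 0ℓ; lift)
open import Algebra.Properties.CommutativeSemigroup using (interchange)
open import Data.Bool using (true; false; _xor_)
open import Data.Bool.Properties using (xor-comm)
open import Data.Empty using (⊥; ⊥-elim)
open import Data.Fin as Fin using (Fin)
open import Data.List using (List; []; _∷_; _++_; concatMap; length; lookup)
import Data.List as List
import Data.List.Properties as Listₚ
import Data.List.Relation.Unary.All as All
open All using ([]; _∷_)
import Data.List.Relation.Unary.All.Properties as Allₚ
open import Data.List.Membership.Propositional.Properties using (∈-lookup)
open import Data.Nat as ℕ using (ℕ; zero; suc; _≤_; _≤?_; z≤n; s≤s; _∸_; ⌈_/2⌉)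
import Data.Nat.Properties as ℕₚ
open import Data.Nat.DivMod using (m/n≡1+[m∸n]/n)
open import Data.Product using (∃; _×_; _,_; proj₁; proj₂)
open import Data.Sum as Sum using (_⊎_; inj₁; inj₂)
import Data.Vec as Vec
open Vec using ([]; _∷_; replicate)
import Data.Vec.Properties as Vecₚ
open import Function using (_∘_; id)
open import Relation.Binary.Bundles using (Setoid)
open import Relation.Binary.Core using (Rel)
open import Relation.Binary.Definitions using (tri<; tri≈; tri>)
open import Relation.Binary.PropositionalEquality
  using (_≡_; _≢_; refl; sym; trans; cong; cong₂; subst; subst₂)
import Relation.Binary.Reasoning.Setoid as SetoidReasoning
open import Relation.Binary.Structures using (IsStrictTotalOrder)
open import Relation.Nullary using (¬_; Dec; yes; no)

private variable n : ℕ

-- Monomials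

·ₘ-comm : (a b : Monomial n) → a ·ₘ b ≡ b ·ₘ a
·ₘ-comm = Vecₚ.zipWith-comm ℕₚ.+-comm

·ₘ-assoc : (a b c : Monomial n) → (a ·ₘ b) ·ₘ c ≡ a ·ₘ (b ·ₘ c)
·ₘ-assoc = Vecₚ.zipWith-assoc ℕₚ.+-assoc

·ₘ-identityˡ : (a : Monomial n) → oneₘ ·ₘ a ≡ a
·ₘ-identityˡ = Vecₚ.zipWith-identityˡ ℕₚ.+-identityˡ

·ₘ-identityʳ : (a : Monomial n) → a ·ₘ oneₘ ≡ a
·ₘ-identityʳ = Vecₚ.zipWith-identityʳ ℕₚ.+-identityʳ

·ₘ-cancelˡ : (a b c : Monomial n) → a ·ₘ b ≡ a ·ₘ c → b ≡ c
·ₘ-cancelˡ []      []      []      _  = refl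
·ₘ-cancelˡ (x ∷ a) (y ∷ b) (z ∷ c) eq =
  cong₂ _∷_ (ℕₚ.+-cancelˡ-≡ x y z (cong Vec.head eq)) (·ₘ-cancelˡ a b c (cong Vec.tail eq))

deg-·ₘ : (a b : Monomial n) → deg (a ·ₘ b) ≡ deg a ℕ.+ deg b
deg-·ₘ []      []      = refl
deg-·ₘ (x ∷ a) (y ∷ b) =
  trans (cong (x ℕ.+ y ℕ.+_) (deg-·ₘ a b))
        (interchange ℕₚ.+-commutativeSemigroup x y (deg a) (deg b))

deg-oneₘ : deg (oneₘ {n}) ≡ 0
deg-oneₘ {zero}  = refl
deg-oneₘ {suc n} = deg-oneₘ {n}

deg-var : (k : Fin n) → deg (var k) ≡ 1
deg-var {suc n} Fin.zero    = cong suc (deg-oneₘ {n})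
deg-var         (Fin.suc k) = deg-var k

deg-var·ₘ : (k : Fin n) (a : Monomial n) → deg (var k ·ₘ a) ≡ suc (deg a)
deg-var·ₘ k a = trans (deg-·ₘ (var k) a) (cong (ℕ._+ deg a) (deg-var k))

deg-square : (k : Fin n) → deg (var k ·ₘ var k) ≡ 2
deg-square k = trans (deg-var·ₘ k (var k)) (cong suc (deg-var k))

deg≡0⇒≡oneₘ : (a : Monomial n) → deg a ≡ 0 → a ≡ oneₘ
deg≡0⇒≡oneₘ []         _  = refl
deg≡0⇒≡oneₘ (zero ∷ a) eq = cong (0 ∷_) (deg≡0⇒≡oneₘ a eq)

var≢oneₘ : (k : Fin n) → var k ≢ oneₘ
var≢oneₘ {n} k x≡1 with trans (sym (deg-var k)) (trans (cong deg x≡1) (deg-oneₘ {n}))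
... | ()

square≢oneₘ : (k : Fin n) → var k ·ₘ var k ≢ oneₘ
square≢oneₘ {n} k x²≡1 with trans (sym (deg-square k)) (trans (cong deg x²≡1) (deg-oneₘ {n}))
... | ()

lookup-var·ₘ : (k : Fin n) (a : Monomial n) → Vec.lookup (var k ·ₘ a) k ≡ suc (Vec.lookup a k)
lookup-var·ₘ {n} k a =
  trans (Vecₚ.lookup-zipWith ℕ._+_ k (var k) a)
        (cong (ℕ._+ Vec.lookup a k) (Vecₚ.lookup∘updateAt k (replicate n 0)))

∣ₘ-trans : {a b c : Monomial n} → a ∣ₘ b → b ∣ₘ c → a ∣ₘ c
∣ₘ-trans {a = a} (d , refl) (e , refl) = d ·ₘ e , sym (·ₘ-assoc a d e)

∣ₘ⇒deg≤ : {a b : Monomial n} → a ∣ₘ b → deg a ≤ deg b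
∣ₘ⇒deg≤ {a = a} (c , refl) = subst (deg a ≤_) (sym (deg-·ₘ a c)) (ℕₚ.m≤m+n (deg a) (deg c))

∣ₘ⇒lookup≤ : {a b : Monomial n} (k : Fin n) → a ∣ₘ b → Vec.lookup a k ≤ Vec.lookup b k
∣ₘ⇒lookup≤ {a = a} k (c , refl) =
  subst (Vec.lookup a k ≤_) (sym (Vecₚ.lookup-zipWith ℕ._+_ k a c)) (ℕₚ.m≤m+n _ _)

_∣ₘ?_ : (a b : Monomial n) → Dec (a ∣ₘ b)
[]      ∣ₘ? []      = yes ([] , refl)
(x ∷ a) ∣ₘ? (y ∷ b) with x ≤? y | a ∣ₘ? b
... | yes x≤y | yes (c , refl) = yes (y ∸ x ∷ c , cong (_∷ a ·ₘ c) (ℕₚ.m+[n∸m]≡n x≤y))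
... | no  x≰y | _              =
  no λ { (z ∷ c , eq) → x≰y (subst (x ≤_) (cong Vec.head eq) (ℕₚ.m≤m+n x z)) }
... | _       | no  a∤b        = no λ { (z ∷ c , eq) → a∤b (c , cong Vec.tail eq) }

factor-var : (a : Monomial n) (k : Fin n) → 1 ≤ Vec.lookup a k → ∃ λ b → a ≡ var k ·ₘ b
factor-var (suc x ∷ a) Fin.zero    _ = x ∷ a , cong (suc x ∷_) (sym (·ₘ-identityˡ a))
factor-var (x ∷ a)     (Fin.suc k) h with factor-var a k h
... | b , refl = x ∷ b , refl

factor-square : (a : Monomial n) (k : Fin n) → 2 ≤ Vec.lookup a k →
                ∃ λ b → a ≡ (var k ·ₘ var k) ·ₘ b
factor-square a k h with factor-var a k (ℕₚ.≤-trans (s≤s z≤n) h)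
... | b , refl with factor-var b k (ℕₚ.≤-pred (subst (2 ≤_) (lookup-var·ₘ k b) h))
... | c , refl = c , sym (·ₘ-assoc (var k) (var k) c)

≢oneₘ⇒∃lookup≥1 : (a : Monomial n) → a ≢ oneₘ → ∃ λ k → 1 ≤ Vec.lookup a k
≢oneₘ⇒∃lookup≥1 []          a≢1 = ⊥-elim (a≢1 refl)
≢oneₘ⇒∃lookup≥1 (suc x ∷ a) _   = Fin.zero , s≤s z≤n
≢oneₘ⇒∃lookup≥1 (zero ∷ a)  a≢1 with ≢oneₘ⇒∃lookup≥1 a (a≢1 ∘ cong (0 ∷_))
... | k , h = Fin.suc k , h

SquareFree : Monomial n → Set
SquareFree a = ∀ k → Vec.lookup a k ≤ 1

squareFree-or-square : (a : Monomial n) → SquareFree a ⊎ ∃ λ k → 2 ≤ Vec.lookup a k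
squareFree-or-square []      = inj₁ λ ()
squareFree-or-square (x ∷ a) with x ≤? 1 | squareFree-or-square a
... | no  x≰1 | _            = inj₂ (Fin.zero , ℕₚ.≰⇒> x≰1)
... | yes _   | inj₂ (k , h) = inj₂ (Fin.suc k , h)
... | yes x≤1 | inj₁ a-sf    = inj₁ λ { Fin.zero → x≤1 ; (Fin.suc k) → a-sf k }

-- Parity vectors and their weights

⊕ʷ-comm : (a b : Word n) → a ⊕ʷ b ≡ b ⊕ʷ a
⊕ʷ-comm = Vecₚ.zipWith-comm xor-comm

parity-double : ∀ k → parity (k ℕ.+ k) ≡ false
parity-double zero    = refl
parity-double (suc k) = trans (cong (parity ∘ suc) (ℕₚ.+-suc k k)) (parity-double k)

ψ-square⊕ψ-oneₘ : (a : Monomial n) → ψ (a ·ₘ a) ⊕ʷ ψ (oneₘ {n}) ≡ replicate n false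
ψ-square⊕ψ-oneₘ []      = refl
ψ-square⊕ψ-oneₘ (x ∷ a) = cong₂ _∷_ (cong (_xor false) (parity-double x)) (ψ-square⊕ψ-oneₘ a)

weight-ψ≤deg : (a : Monomial n) → weight (ψ a) ≤ deg a
weight-ψ≤deg []          = z≤n
weight-ψ≤deg (zero ∷ a)  = weight-ψ≤deg a
weight-ψ≤deg (suc x ∷ a) with parity (suc x)
... | true  = s≤s (ℕₚ.≤-trans (weight-ψ≤deg a) (ℕₚ.m≤n+m (deg a) x))
... | false = ℕₚ.≤-trans (weight-ψ≤deg a) (ℕₚ.≤-trans (ℕₚ.m≤n+m (deg a) x) (ℕₚ.n≤1+n _))

weight-ψ-squareFree : (a : Monomial n) → SquareFree a → weight (ψ a) ≡ deg a
weight-ψ-squareFree []                _  = refl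
weight-ψ-squareFree (zero ∷ a)        sf = weight-ψ-squareFree a (sf ∘ Fin.suc)
weight-ψ-squareFree (suc zero ∷ a)    sf = cong suc (weight-ψ-squareFree a (sf ∘ Fin.suc))
weight-ψ-squareFree (suc (suc x) ∷ a) sf with sf Fin.zero
... | s≤s ()

weight-ψ⊕ψ : (a b : Monomial n) → (∀ k → 1 ≤ Vec.lookup a k → Vec.lookup b k ≡ 0) →
             SquareFree b → weight (ψ a ⊕ʷ ψ b) ≡ weight (ψ a) ℕ.+ deg b
weight-ψ⊕ψ []      []      _    _  = refl
weight-ψ⊕ψ (x ∷ a) (y ∷ b) disj sf with weight-ψ⊕ψ a b (disj ∘ Fin.suc) (sf ∘ Fin.suc)
weight-ψ⊕ψ (zero ∷ a)  (zero ∷ b)        _    _  | ih = ih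
weight-ψ⊕ψ (zero ∷ a)  (suc zero ∷ b)    _    _  | ih = trans (cong suc ih) (sym (ℕₚ.+-suc _ _))
weight-ψ⊕ψ (zero ∷ a)  (suc (suc y) ∷ b) _    sf | _  with sf Fin.zero
... | s≤s ()
weight-ψ⊕ψ (suc x ∷ a) (suc y ∷ b)       disj _  | _  with disj Fin.zero (s≤s z≤n)
... | ()
weight-ψ⊕ψ (suc x ∷ a) (zero ∷ b)        _    _  | ih with parity (suc x)
... | true  = cong suc ih
... | false = ih

-- Arithmetic of t′

tPrime≡⌈/2⌉ : ∀ d → tPrime d ≡ ⌈ d /2⌉
tPrime≡⌈/2⌉ zero                = refl
tPrime≡⌈/2⌉ (suc zero)          = refl
tPrime≡⌈/2⌉ (suc (suc zero))    = refl
tPrime≡⌈/2⌉ (suc (suc (suc d))) =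
  trans (cong (ℕ._+ 1) (m/n≡1+[m∸n]/n {suc (suc d)} {2} (s≤s (s≤s z≤n))))
        (cong suc (tPrime≡⌈/2⌉ (suc d)))

⌈n+n/2⌉≡n : ∀ s → ⌈ s ℕ.+ s /2⌉ ≡ s
⌈n+n/2⌉≡n zero    = refl
⌈n+n/2⌉≡n (suc s) = trans (cong (λ k → ⌈ suc k /2⌉) (ℕₚ.+-suc s s)) (cong suc (⌈n+n/2⌉≡n s))

tPrime≤ : ∀ {d s} → d ≤ s ℕ.+ s → tPrime d ≤ s
tPrime≤ {d} {s} d≤s+s = begin
  tPrime d       ≡⟨ tPrime≡⌈/2⌉ d ⟩
  ⌈ d /2⌉        ≤⟨ ℕₚ.⌈n/2⌉-mono d≤s+s ⟩
  ⌈ s ℕ.+ s /2⌉  ≡⟨ ⌈n+n/2⌉≡n s ⟩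
  s              ∎
  where open ℕₚ.≤-Reasoning

≤suc-tPrime : ∀ {s r} → s ≤ 2 ℕ.+ r → s ≤ suc (tPrime (s ℕ.+ r))
≤suc-tPrime {s} {r} s≤2+r = begin
  s                      ≡⟨ ⌈n+n/2⌉≡n s ⟨
  ⌈ s ℕ.+ s /2⌉          ≤⟨ ℕₚ.⌈n/2⌉-mono s+s≤2+[s+r] ⟩
  ⌈ 2 ℕ.+ (s ℕ.+ r) /2⌉  ≡⟨ cong suc (tPrime≡⌈/2⌉ (s ℕ.+ r)) ⟨
  suc (tPrime (s ℕ.+ r)) ∎
  where
  open ℕₚ.≤-Reasoning
  s+s≤2+[s+r] : s ℕ.+ s ≤ 2 ℕ.+ (s ℕ.+ r)
  s+s≤2+[s+r] = ℕₚ.≤-trans (ℕₚ.+-monoʳ-≤ s s≤2+r)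
                  (ℕₚ.≤-reflexive (trans (ℕₚ.+-suc s (suc r)) (cong suc (ℕₚ.+-suc s r))))

tPrime≥1 : ∀ {d} → 1 ≤ d → 1 ≤ tPrime d
tPrime≥1 {suc d} _ = subst (1 ≤_) (sym (tPrime≡⌈/2⌉ (suc d))) (s≤s z≤n)

≤∧≤suc⇒≡⊎≡suc : ∀ {s t} → t ≤ s → s ≤ suc t → s ≡ t ⊎ s ≡ suc t
≤∧≤suc⇒≡⊎≡suc t≤s s≤1+t =
  Sum.map₁ (λ s<1+t → ℕₚ.≤-antisym (ℕₚ.m<1+n⇒m≤n s<1+t) t≤s) (ℕₚ.m≤n⇒m<n∨m≡n s≤1+t)

-- Polynomials, ideals and binomials

module PolynomialIdeals {c ℓ : Level} (F : Field c ℓ) (n : ℕ) where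

  open Field F renaming (refl to ≈-refl; sym to ≈-sym; trans to ≈-trans)
  open Polynomials F n
  open import Algebra.Properties.Ring ring using (-1*x≈-x; -‿involutive; -0#≈0#)
  open import Algebra.Properties.CommutativeSemigroup +-commutativeSemigroup using (x∙yz≈y∙xz)

  ≈ₚ-setoid : Setoid c ℓ
  ≈ₚ-setoid = record
    { Carrier       = Poly
    ; _≈_           = _≈ₚ_
    ; isEquivalence = record
      { refl  = λ _ → ≈-refl
      ; sym   = λ p≈q z → ≈-sym (p≈q z)
      ; trans = λ p≈q q≈r z → ≈-trans (p≈q z) (q≈r z)
      }
    }

  ≈ₚ-refl : ∀ p → p ≈ₚ p
  ≈ₚ-refl p = Setoid.refl ≈ₚ-setoid {p}

  coeff-++ : ∀ p q z → coeff (p ++ q) z ≈ coeff p z + coeff q z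
  coeff-++ []            q z = ≈-sym (+-identityˡ _)
  coeff-++ ((a , x) ∷ p) q z with x ≟ₘ z
  ... | yes _ = ≈-trans (+-congˡ (coeff-++ p q z)) (≈-sym (+-assoc _ _ _))
  ... | no  _ = coeff-++ p q z

  ++-cong : ∀ p p′ q q′ → p ≈ₚ p′ → q ≈ₚ q′ → (p ++ q) ≈ₚ (p′ ++ q′)
  ++-cong p p′ q q′ p≈p′ q≈q′ z =
    ≈-trans (coeff-++ p q z) (≈-trans (+-cong (p≈p′ z) (q≈q′ z)) (≈-sym (coeff-++ p′ q′ z)))

  ∷-cong : ∀ {a b} x y p q → a ≈ b → x ≡ y → p ≈ₚ q → ((a , x) ∷ p) ≈ₚ ((b , y) ∷ q)
  ∷-cong x _ p q a≈b refl p≈q z with x ≟ₘ z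
  ... | yes _ = +-cong a≈b (p≈q z)
  ... | no  _ = p≈q z

  ∷-swap : ∀ a b x y p → ((a , x) ∷ (b , y) ∷ p) ≈ₚ ((b , y) ∷ (a , x) ∷ p)
  ∷-swap a b x y p z with x ≟ₘ z | y ≟ₘ z
  ... | yes _ | yes _ = x∙yz≈y∙xz _ _ _
  ... | yes _ | no  _ = ≈-refl
  ... | no  _ | yes _ = ≈-refl
  ... | no  _ | no  _ = ≈-refl

  ∷-merge : ∀ a b x p → ((a , x) ∷ (b , x) ∷ p) ≈ₚ ((a + b , x) ∷ p)
  ∷-merge a b x p z with x ≟ₘ z
  ... | yes _ = ≈-sym (+-assoc _ _ _)
  ... | no  _ = ≈-refl

  ∷-drop : ∀ {a} x p → a ≈ 0# → ((a , x) ∷ p) ≈ₚ p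
  ∷-drop x p a≈0 z with x ≟ₘ z
  ... | yes _ = ≈-trans (+-congʳ a≈0) (+-identityˡ _)
  ... | no  _ = ≈-refl

  coeff-scaleMon : ∀ a x p y → coeff (scaleMon a x p) (x ·ₘ y) ≈ a * coeff p y
  coeff-scaleMon a x []            y = ≈-sym (zeroʳ a)
  coeff-scaleMon a x ((b , t) ∷ p) y with t ≟ₘ y | (x ·ₘ t) ≟ₘ (x ·ₘ y)
  ... | yes _   | yes _     = ≈-trans (+-congˡ (coeff-scaleMon a x p y)) (≈-sym (distribˡ a b _))
  ... | yes t≡y | no  xt≢xy = ⊥-elim (xt≢xy (cong (x ·ₘ_) t≡y))
  ... | no  t≢y | yes xt≡xy = ⊥-elim (t≢y (·ₘ-cancelˡ x t y xt≡xy))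
  ... | no  _   | no  _     = coeff-scaleMon a x p y

  coeff-scaleMon-∤ : ∀ a x p z → ¬ (x ∣ₘ z) → coeff (scaleMon a x p) z ≈ 0#
  coeff-scaleMon-∤ a x []            z _   = ≈-refl
  coeff-scaleMon-∤ a x ((b , t) ∷ p) z x∤z with (x ·ₘ t) ≟ₘ z
  ... | yes xt≡z = ⊥-elim (x∤z (t , xt≡z))
  ... | no  _    = coeff-scaleMon-∤ a x p z x∤z

  scaleMon-cong : ∀ a x p q → p ≈ₚ q → scaleMon a x p ≈ₚ scaleMon a x q
  scaleMon-cong a x p q p≈q z with x ∣ₘ? z
  ... | yes (y , refl) =
    ≈-trans (coeff-scaleMon a x p y) (≈-trans (*-congˡ (p≈q y)) (≈-sym (coeff-scaleMon a x q y)))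
  ... | no  x∤z        =
    ≈-trans (coeff-scaleMon-∤ a x p z x∤z) (≈-sym (coeff-scaleMon-∤ a x q z x∤z))

  scaleMon-scaleMon : ∀ b x a y p →
                      scaleMon b x (scaleMon a y p) ≈ₚ scaleMon (b * a) (x ·ₘ y) p
  scaleMon-scaleMon b x a y []            = ≈ₚ-refl []
  scaleMon-scaleMon b x a y ((d , t) ∷ p) =
    ∷-cong _ _ (scaleMon b x (scaleMon a y p)) (scaleMon (b * a) (x ·ₘ y) p)
           (≈-sym (*-assoc b a d)) (sym (·ₘ-assoc x y t)) (scaleMon-scaleMon b x a y p)

  combination : List (Carrier × Monomial n × Poly) → Poly
  combination = concatMap (λ t → scaleMon (proj₁ t) (proj₁ (proj₂ t)) (proj₂ (proj₂ t)))

  rescale : Carrier → Monomial n → Carrier × Monomial n × Poly → Carrier × Monomial n × Poly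
  rescale b x (a , y , p) = b * a , x ·ₘ y , p

  scaleMon-combination : ∀ b x ts →
    scaleMon b x (combination ts) ≈ₚ combination (List.map (rescale b x) ts)
  scaleMon-combination b x []                 = ≈ₚ-refl []
  scaleMon-combination b x ((a , y , p) ∷ ts)
    rewrite Listₚ.map-++ (λ t → b * proj₁ t , x ·ₘ proj₂ t) (scaleMon a y p) (combination ts) =
    ++-cong (scaleMon b x (scaleMon a y p)) (scaleMon (b * a) (x ·ₘ y) p)
            (scaleMon b x (combination ts)) (combination (List.map (rescale b x) ts))
            (scaleMon-scaleMon b x a y p) (scaleMon-combination b x ts)

  -1≉0 : ¬ (- 1# ≈ 0#)
  -1≉0 -1≈0 = 1≉0 (≈-trans (≈-sym (-‿involutive 1#)) (≈-trans (-‿cong -1≈0) -0#≈0#))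

  -1*-1≈1 : - 1# * - 1# ≈ 1#
  -1*-1≈1 = ≈-trans (-1*x≈-x (- 1#)) (-‿involutive 1#)

  binom-support : ∀ w v z → InSupp (binom w v) z → z ≡ w ⊎ z ≡ v
  binom-support w v z z∈supp with w ≟ₘ z | v ≟ₘ z
  ... | yes w≡z | _       = inj₁ (sym w≡z)
  ... | no  _   | yes v≡z = inj₂ (sym v≡z)
  ... | no  _   | no  _   = ⊥-elim (z∈supp ≈-refl)

  binom-self : ∀ w → binom w w ≈ₚ []
  binom-self w z with w ≟ₘ z
  ... | yes _ = ≈-trans (+-congˡ (+-identityʳ _)) (-‿inverseʳ 1#)
  ... | no  _ = ≈-refl

  coeff-binomˡ : ∀ {w v} → w ≢ v → coeff (binom w v) w ≈ 1#
  coeff-binomˡ {w} {v} w≢v with w ≟ₘ w | v ≟ₘ w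
  ... | no  w≢w | _       = ⊥-elim (w≢w refl)
  ... | yes _   | yes v≡w = ⊥-elim (w≢v (sym v≡w))
  ... | yes _   | no  _   = +-identityʳ _

  coeff-binomʳ : ∀ {w v} → w ≢ v → coeff (binom w v) v ≈ - 1#
  coeff-binomʳ {w} {v} w≢v with w ≟ₘ v | v ≟ₘ v
  ... | yes w≡v | _       = ⊥-elim (w≢v w≡v)
  ... | no  _   | no  v≢v = ⊥-elim (v≢v refl)
  ... | no  _   | yes _   = +-identityʳ _

  binom-IsLM : (_<_ : Rel (Monomial n) 0ℓ) → ∀ {w v} → v < w → w ≢ v → IsLM _<_ (binom w v) w
  binom-IsLM _<_ {w} {v} v<w w≢v =
    (λ w∉supp → 1≉0 (≈-trans (≈-sym (coeff-binomˡ w≢v)) w∉supp)) ,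
    λ z z∈supp → Sum.map₂ (λ z≡v → subst (_< w) (sym z≡v) v<w) (binom-support w v z z∈supp)

  binom-comm : - 1# ≈ 1# → ∀ w v → binom w v ≈ₚ binom v w
  binom-comm -1≈1 w v = begin
    (1# , w) ∷ (- 1# , v) ∷ []  ≈⟨ ∷-swap 1# (- 1#) w v [] ⟩
    (- 1# , v) ∷ (1# , w) ∷ []  ≈⟨ ∷-cong v v ((1# , w) ∷ []) ((- 1# , w) ∷ []) -1≈1 refl
                                     (∷-cong w w [] [] (≈-sym -1≈1) refl (≈ₚ-refl [])) ⟩
    (1# , v) ∷ (- 1# , w) ∷ []  ∎
    where open SetoidReasoning ≈ₚ-setoid

  module _ (S : Poly → Set (c ⊔ ℓ)) where

    ∈-resp-≈ₚ : ∀ f f′ → f ≈ₚ f′ → InIdeal S f′ → InIdeal S f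
    ∈-resp-≈ₚ f f′ f≈f′ (ts , S-ts , f′≈ts) = ts , S-ts , λ z → ≈-trans (f≈f′ z) (f′≈ts z)

    ∈-++ : ∀ f f′ → InIdeal S f → InIdeal S f′ → InIdeal S (f ++ f′)
    ∈-++ f f′ (ts , S-ts , f≈ts) (ts′ , S-ts′ , f′≈ts′) =
      ts List.++ ts′ , Allₚ.++⁺ S-ts S-ts′ ,
      λ z → ≈-trans (++-cong f (combination ts) f′ (combination ts′) f≈ts f′≈ts′ z)
              (reflexive (cong (λ p → coeff p z) (sym (Listₚ.concatMap-++ _ ts ts′))))

    ∈-scaleMon : ∀ b x f → InIdeal S f → InIdeal S (scaleMon b x f)
    ∈-scaleMon b x f (ts , S-ts , f≈ts) =
      List.map (rescale b x) ts , Allₚ.map⁺ S-ts ,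
      λ z → ≈-trans (scaleMon-cong b x f (combination ts) f≈ts z) (scaleMon-combination b x ts z)

    generator-∈ : ∀ {s} → S s → InIdeal S s
    generator-∈ {s} S-s = (1# , oneₘ , s) ∷ [] , S-s ∷ [] , λ z → ≈-sym (begin
      coeff (scaleMon 1# oneₘ s ++ []) z     ≈⟨ coeff-++ (scaleMon 1# oneₘ s) [] z ⟩
      coeff (scaleMon 1# oneₘ s) z + 0#      ≈⟨ +-identityʳ _ ⟩
      coeff (scaleMon 1# oneₘ s) z           ≡⟨ cong (coeff (scaleMon 1# oneₘ s)) (·ₘ-identityˡ z) ⟨
      coeff (scaleMon 1# oneₘ s) (oneₘ ·ₘ z) ≈⟨ coeff-scaleMon 1# oneₘ s z ⟩
      1# * coeff s z                         ≈⟨ *-identityˡ _ ⟩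
      coeff s z                              ∎)
      where open SetoidReasoning setoid

    binom-sym-∈ : ∀ w v → InIdeal S (binom w v) → InIdeal S (binom v w)
    binom-sym-∈ w v =
      ∈-resp-≈ₚ (binom v w) (scaleMon (- 1#) oneₘ (binom w v)) v-w≈-[w-v] ∘
      ∈-scaleMon (- 1#) oneₘ (binom w v)
      where
      v-w≈-[w-v] : binom v w ≈ₚ scaleMon (- 1#) oneₘ (binom w v)
      v-w≈-[w-v] = begin
        (1# , v) ∷ (- 1# , w) ∷ []
          ≈⟨ ∷-swap 1# (- 1#) v w [] ⟩
        (- 1# , w) ∷ (1# , v) ∷ []
          ≈⟨ ∷-cong w (oneₘ ·ₘ w) ((1# , v) ∷ []) ((- 1# * - 1# , oneₘ ·ₘ v) ∷ [])
                    (≈-sym (*-identityʳ _)) (sym (·ₘ-identityˡ w))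
                    (∷-cong v (oneₘ ·ₘ v) [] [] (≈-sym -1*-1≈1) (sym (·ₘ-identityˡ v))
                            (≈ₚ-refl [])) ⟩
        (- 1# * 1# , oneₘ ·ₘ w) ∷ (- 1# * - 1# , oneₘ ·ₘ v) ∷ []
          ∎
        where open SetoidReasoning ≈ₚ-setoid

    binom-·ₘ-∈ : ∀ x w v → InIdeal S (binom w v) → InIdeal S (binom (x ·ₘ w) (x ·ₘ v))
    binom-·ₘ-∈ x w v =
      ∈-resp-≈ₚ (binom (x ·ₘ w) (x ·ₘ v)) (scaleMon 1# x (binom w v)) xw-xv≈x[w-v] ∘
      ∈-scaleMon 1# x (binom w v)
      where
      xw-xv≈x[w-v] : binom (x ·ₘ w) (x ·ₘ v) ≈ₚ scaleMon 1# x (binom w v)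
      xw-xv≈x[w-v] =
        ∷-cong (x ·ₘ w) (x ·ₘ w) ((- 1# , x ·ₘ v) ∷ []) ((1# * - 1# , x ·ₘ v) ∷ [])
               (≈-sym (*-identityˡ _)) refl
               (∷-cong (x ·ₘ v) (x ·ₘ v) [] [] (≈-sym (*-identityˡ _)) refl (≈ₚ-refl []))

    binom-reduce-∈ : ∀ x w v → InIdeal S (binom (x ·ₘ x) oneₘ) →
                     InIdeal S (binom (w ·ₘ (x ·ₘ x)) v) → InIdeal S (binom w v)
    binom-reduce-∈ x w v x²-1∈ wx²-v∈ =
      ∈-resp-≈ₚ (binom w v) (binom wx² v ++ w[x²-1]) w-v≈wx²-v-w[x²-1]
        (∈-++ (binom wx² v) w[x²-1] wx²-v∈ (∈-scaleMon (- 1#) w (binom (x ·ₘ x) oneₘ) x²-1∈))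
      where
      wx² : Monomial n
      wx² = w ·ₘ (x ·ₘ x)
      w[x²-1] : Poly
      w[x²-1] = scaleMon (- 1#) w (binom (x ·ₘ x) oneₘ)
      w′ : Carrier × Monomial n
      w′ = - 1# * - 1# , w ·ₘ oneₘ
      w-v≈wx²-v-w[x²-1] : binom w v ≈ₚ (binom wx² v ++ w[x²-1])
      w-v≈wx²-v-w[x²-1] = begin
        (1# , w) ∷ (- 1# , v) ∷ []
          ≈⟨ ∷-cong (w ·ₘ oneₘ) w ((- 1# , v) ∷ []) ((- 1# , v) ∷ [])
                    -1*-1≈1 (·ₘ-identityʳ w) (≈ₚ-refl ((- 1# , v) ∷ [])) ⟨
        w′ ∷ (- 1# , v) ∷ []
          ≈⟨ ∷-swap (- 1#) (- 1# * - 1#) v (w ·ₘ oneₘ) [] ⟨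
        (- 1# , v) ∷ w′ ∷ []
          ≈⟨ ∷-drop wx² ((- 1# , v) ∷ w′ ∷ []) (≈-trans (+-congˡ (*-identityʳ _)) (-‿inverseʳ 1#)) ⟨
        (1# + - 1# * 1# , wx²) ∷ (- 1# , v) ∷ w′ ∷ []
          ≈⟨ ∷-merge 1# (- 1# * 1#) wx² ((- 1# , v) ∷ w′ ∷ []) ⟨
        (1# , wx²) ∷ (- 1# * 1# , wx²) ∷ (- 1# , v) ∷ w′ ∷ []
          ≈⟨ ∷-cong wx² wx² ((- 1# , v) ∷ (- 1# * 1# , wx²) ∷ w′ ∷ [])
                    ((- 1# * 1# , wx²) ∷ (- 1# , v) ∷ w′ ∷ [])
                    ≈-refl refl (∷-swap (- 1#) (- 1# * 1#) v wx² (w′ ∷ [])) ⟨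
        (1# , wx²) ∷ (- 1# , v) ∷ (- 1# * 1# , wx²) ∷ w′ ∷ []
          ∎
        where open SetoidReasoning ≈ₚ-setoid

-- The reduced Gröbner basis of I(C)

module ReducedGroebnerBasisOfCode
    {c ℓ : Level} (F : Field c ℓ) {n : ℕ}
    (C : Word n → Set) (C-linear : IsBinaryLinearCode C)
    (_<_ : Rel (Monomial n) 0ℓ) (<-termOrder : IsTermOrder _<_)
    (<-degCompatible : IsDegCompatible _<_)
    (G : List (Polynomials.Poly F n))
    (G-reducedGB : Polynomials.IsReducedGB F n _<_ (Polynomials.I[_] F n C) G) where

  open Field F using (_≈_; 1#; -_) renaming (sym to ≈-sym; trans to ≈-trans)
  open Polynomials F n
  open PolynomialIdeals F n
  open IsTermOrder <-termOrder
  open IsStrictTotalOrder strictTotal using (compare; asym; irrefl)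
  open IsReducedGB G-reducedGB

  IsLM-unique : ∀ f {a b} → IsLM _<_ f a → IsLM _<_ f b → a ≡ b
  IsLM-unique f {b = b} (a∈supp , a-max) (b∈supp , b-max) with a-max b b∈supp | b-max _ a∈supp
  ... | inj₁ b≡a | _        = sym b≡a
  ... | inj₂ _   | inj₁ a≡b = a≡b
  ... | inj₂ b<a | inj₂ a<b = ⊥-elim (asym b<a a<b)

  ·ₘ-cancelˡ-< : ∀ x {a b} → (x ·ₘ a) < (x ·ₘ b) → a < b
  ·ₘ-cancelˡ-< x {a} {b} xa<xb with compare a b
  ... | tri< a<b _ _  = a<b
  ... | tri≈ _ refl _ = ⊥-elim (irrefl refl xa<xb)
  ... | tri> _ _ b<a  =
    ⊥-elim (asym xa<xb (subst₂ _<_ (·ₘ-comm b x) (·ₘ-comm a x) (multiplicative b a x b<a)))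

  x²-1∈I : ∀ x → I[ C ] (binom (x ·ₘ x) oneₘ)
  x²-1∈I x = generator-∈ (CodeGen C) (lift (x ·ₘ x , oneₘ , x²⊕1∈C , refl))
    where
    x²⊕1∈C : C (ψ (x ·ₘ x) ⊕ʷ ψ oneₘ)
    x²⊕1∈C = subst C (sym (ψ-square⊕ψ-oneₘ x)) (IsBinaryLinearCode.zero∈ C-linear)

  var²-1-IsLM : ∀ k → IsLM _<_ (binom (var k ·ₘ var k) oneₘ) (var k ·ₘ var k)
  var²-1-IsLM k = binom-IsLM _<_ (one-least _ (square≢oneₘ k)) (square≢oneₘ k)

  binom-reduce-square-∈ : ∀ x a b → I[ C ] (binom (x ·ₘ (x ·ₘ a)) b) → I[ C ] (binom a b)
  binom-reduce-square-∈ x a b =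
    binom-reduce-∈ (CodeGen C) x a b (x²-1∈I x) ∘ subst (λ xxa → I[ C ] (binom xxa b)) x[xa]≡a[xx]
    where
    x[xa]≡a[xx] : x ·ₘ (x ·ₘ a) ≡ a ·ₘ (x ·ₘ x)
    x[xa]≡a[xx] = trans (sym (·ₘ-assoc x x a)) (·ₘ-comm (x ·ₘ x) a)

  binom-shift-∈ : ∀ x a b → I[ C ] (binom (x ·ₘ a) b) → I[ C ] (binom a (x ·ₘ b))
  binom-shift-∈ x a b = binom-reduce-square-∈ x a (x ·ₘ b) ∘ binom-·ₘ-∈ (CodeGen C) x (x ·ₘ a) b

  binom-cancel-∈ : ∀ x a b → I[ C ] (binom (x ·ₘ a) (x ·ₘ b)) → I[ C ] (binom a b)
  binom-cancel-∈ x a b =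
    binom-sym-∈ (CodeGen C) b a ∘ binom-reduce-square-∈ x b a ∘
    binom-sym-∈ (CodeGen C) a (x ·ₘ (x ·ₘ b)) ∘ binom-shift-∈ x a (x ·ₘ b)

  LM∣LM-dividing-supp : ∀ i {m z m′} f → IsLM _<_ (lookup G i) m → InSupp (lookup G i) z →
                        I[ C ] f → IsLM _<_ f m′ → m′ ∣ₘ z → m ∣ₘ m′
  LM∣LM-dividing-supp i f m-LM z∈supp f∈I m′-LM m′∣z with groebner f _ f∈I m′-LM
  ... | j , mⱼ , mⱼ-LM , mⱼ∣m′ with j Fin.≟ i
  ...   | yes refl = subst (_∣ₘ _) (IsLM-unique (lookup G i) mⱼ-LM m-LM) mⱼ∣m′
  ...   | no  j≢i  = ⊥-elim (reduced i j (j≢i ∘ sym) _ z∈supp mⱼ mⱼ-LM (∣ₘ-trans mⱼ∣m′ m′∣z))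

  ¬binomial-LM-properly-dividing-LM : ∀ i {a b c} → IsLM _<_ (lookup G i) (a ·ₘ c) → c ≢ oneₘ →
                                      I[ C ] (binom a b) → b < a → ⊥
  ¬binomial-LM-properly-dividing-LM i {a} {b} {c} ac-LM c≢1 a-b∈I b<a =
    ℕₚ.<⇒≱ deg-a<deg-ac
      (∣ₘ⇒deg≤ (LM∣LM-dividing-supp i (binom a b) ac-LM (proj₁ ac-LM) a-b∈I
                  (binom-IsLM _<_ b<a a≢b) (c , refl)))
    where
    a≢b : a ≢ b
    a≢b a≡b = irrefl (sym a≡b) b<a
    deg-a<deg-ac : deg a ℕ.< deg (a ·ₘ c)
    deg-a<deg-ac = subst (deg a ℕ.<_) (sym (deg-·ₘ a c))
                     (ℕₚ.m<m+n (deg a) (ℕₚ.n≢0⇒n>0 (c≢1 ∘ deg≡0⇒≡oneₘ c)))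

  module LeadingTerm (i : Fin (length G)) {m v : Monomial n}
      (g≈m-v : lookup G i ≈ₚ binom m v) (m-LM : IsLM _<_ (lookup G i) m)
      (g≉x²-1 : ∀ k → ¬ (lookup G i ≈ₚ binom (var k ·ₘ var k) oneₘ)) where

    g : Poly
    g = lookup G i

    m≢v : m ≢ v
    m≢v refl = proj₁ m-LM (≈-trans (g≈m-v m) (binom-self m m))

    v∈supp : InSupp g v
    v∈supp v∉supp = -1≉0 (≈-trans (≈-sym (coeff-binomʳ m≢v)) (≈-trans (≈-sym (g≈m-v v)) v∉supp))

    v<m : v < m
    v<m = Sum.[ (λ v≡m → ⊥-elim (m≢v (sym v≡m))) , id ]′ (proj₂ m-LM v v∈supp)

    m-v∈I : I[ C ] (binom m v)
    m-v∈I = ∈-resp-≈ₚ (CodeGen C) (binom m v) g (≈-sym ∘ g≈m-v) (All.lookup ⊆I (∈-lookup i))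

    deg-v≤deg-m : deg v ≤ deg m
    deg-v≤deg-m = ℕₚ.≮⇒≥ (asym v<m ∘ <-degCompatible m v)

    m≢oneₘ : m ≢ oneₘ
    m≢oneₘ refl = asym v<m (one-least v (m≢v ∘ sym))

    LM-after-factoring : ∀ {k a} → m ≡ var k ·ₘ a → IsLM _<_ g (a ·ₘ var k)
    LM-after-factoring {k} {a} m≡xa = subst (IsLM _<_ g) (trans m≡xa (·ₘ-comm (var k) a)) m-LM

    supports-disjoint : ∀ k → 1 ≤ Vec.lookup m k → Vec.lookup v k ≡ 0
    supports-disjoint k 1≤mₖ with Vec.lookup v k in vₖ≡
    ... | zero  = refl
    ... | suc _ with factor-var m k 1≤mₖ | factor-var v k (subst (1 ≤_) (sym vₖ≡) (s≤s z≤n))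
    ...   | m₁ , m≡xm₁ | v₁ , v≡xv₁ =
      ⊥-elim (¬binomial-LM-properly-dividing-LM i (LM-after-factoring m≡xm₁) (var≢oneₘ k)
               (binom-cancel-∈ (var k) m₁ v₁
                 (subst₂ (λ a b → I[ C ] (binom a b)) m≡xm₁ v≡xv₁ m-v∈I))
               (·ₘ-cancelˡ-< (var k) (subst₂ _<_ v≡xv₁ m≡xm₁ v<m)))

    square∣m⇒m≡square : ∀ k → 2 ≤ Vec.lookup m k → m ≡ var k ·ₘ var k
    square∣m⇒m≡square k 2≤mₖ with factor-square m k 2≤mₖ
    ... | r , m≡x²r with r ≟ₘ oneₘ
    ...   | yes refl = trans m≡x²r (·ₘ-identityʳ _)
    ...   | no  r≢1  =
      ⊥-elim (¬binomial-LM-properly-dividing-LM i (subst (IsLM _<_ g) m≡x²r m-LM) r≢1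
               (x²-1∈I (var k)) (one-least _ (square≢oneₘ k)))

    m∤v : ¬ (m ∣ₘ v)
    m∤v m∣v with ≢oneₘ⇒∃lookup≥1 m m≢oneₘ
    ... | k , 1≤mₖ = ℕₚ.<-irrefl refl (subst (1 ≤_) (supports-disjoint k 1≤mₖ)
                                       (ℕₚ.≤-trans 1≤mₖ (∣ₘ⇒lookup≤ k m∣v)))

    v-squareFree : SquareFree v
    v-squareFree j = ℕₚ.≮⇒≥ (m∤v ∘ m∣v)
      where
      m∣v : 2 ≤ Vec.lookup v j → m ∣ₘ v
      m∣v 2≤vⱼ with factor-square v j 2≤vⱼ
      ... | r , v≡x²r =
        ∣ₘ-trans (LM∣LM-dividing-supp i (binom (var j ·ₘ var j) oneₘ) m-LM v∈supp
                    (x²-1∈I (var j)) (var²-1-IsLM j) x²∣v)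
                 x²∣v
        where
        x²∣v : (var j ·ₘ var j) ∣ₘ v
        x²∣v = r , sym v≡x²r

    deg-m≤2+deg-v : deg m ≤ 2 ℕ.+ deg v
    deg-m≤2+deg-v = ℕₚ.≮⇒≥ ¬2+deg-v<deg-m
      where
      ¬2+deg-v<deg-m : ¬ (2 ℕ.+ deg v ℕ.< deg m)
      ¬2+deg-v<deg-m 2+v<m with ≢oneₘ⇒∃lookup≥1 m m≢oneₘ
      ... | k , 1≤mₖ with factor-var m k 1≤mₖ
      ... | m₁ , m≡xm₁ =
        ¬binomial-LM-properly-dividing-LM i (LM-after-factoring m≡xm₁) (var≢oneₘ k)
          (binom-shift-∈ (var k) m₁ v (subst (λ a → I[ C ] (binom a v)) m≡xm₁ m-v∈I))
          (<-degCompatible _ _ deg-xv<deg-m₁)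
        where
        deg-m≡1+deg-m₁ : deg m ≡ suc (deg m₁)
        deg-m≡1+deg-m₁ = trans (cong deg m≡xm₁) (deg-var·ₘ k m₁)
        deg-xv<deg-m₁ : deg (var k ·ₘ v) ℕ.< deg m₁
        deg-xv<deg-m₁ = subst (ℕ._< deg m₁) (sym (deg-var·ₘ k v))
                          (ℕₚ.≤-pred (subst (2 ℕ.+ deg v ℕ.<_) deg-m≡1+deg-m₁ 2+v<m))

    d : ℕ
    d = weight (ψ m ⊕ʷ ψ v)

    d≡weight-ψm+deg-v : d ≡ weight (ψ m) ℕ.+ deg v
    d≡weight-ψm+deg-v = weight-ψ⊕ψ m v supports-disjoint v-squareFree

    tPrime≤deg-m : tPrime d ≤ deg m
    tPrime≤deg-m = tPrime≤ (subst (_≤ deg m ℕ.+ deg m) (sym d≡weight-ψm+deg-v)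
                             (ℕₚ.+-mono-≤ (weight-ψ≤deg m) deg-v≤deg-m))

    deg-m≤suc-tPrime : deg m ≤ suc (tPrime d)
    deg-m≤suc-tPrime with squareFree-or-square m
    ... | inj₁ m-squareFree =
      subst (λ e → deg m ≤ suc (tPrime e)) deg-m+deg-v≡d (≤suc-tPrime deg-m≤2+deg-v)
      where
      deg-m+deg-v≡d : deg m ℕ.+ deg v ≡ d
      deg-m+deg-v≡d = sym (trans d≡weight-ψm+deg-v
                                 (cong (ℕ._+ deg v) (weight-ψ-squareFree m m-squareFree)))
    ... | inj₂ (k , 2≤mₖ) = subst (_≤ suc (tPrime d)) (sym deg-m≡2) (s≤s (tPrime≥1 1≤d))
      where
      m≡x² : m ≡ var k ·ₘ var k
      m≡x² = square∣m⇒m≡square k 2≤mₖ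
      deg-m≡2 : deg m ≡ 2
      deg-m≡2 = trans (cong deg m≡x²) (deg-square k)
      v≢oneₘ : v ≢ oneₘ
      v≢oneₘ v≡1 = g≉x²-1 k (subst₂ (λ a b → g ≈ₚ binom a b) m≡x² v≡1 g≈m-v)
      1≤d : 1 ≤ d
      1≤d = subst (1 ≤_) (sym d≡weight-ψm+deg-v)
              (ℕₚ.≤-trans (ℕₚ.n≢0⇒n>0 (v≢oneₘ ∘ deg≡0⇒≡oneₘ v)) (ℕₚ.m≤n+m (deg v) (weight (ψ m))))

    deg-LM≡tPrime⊎suc : deg m ≡ tPrime d ⊎ deg m ≡ suc (tPrime d)
    deg-LM≡tPrime⊎suc = ≤∧≤suc⇒≡⊎≡suc tPrime≤deg-m deg-m≤suc-tPrime

  binomial-with-LM-first : ∀ i w v {m} → lookup G i ≈ₚ binom w v → IsLM _<_ (lookup G i) m →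
                           ∃ λ v′ → lookup G i ≈ₚ binom m v′ × ψ w ⊕ʷ ψ v ≡ ψ m ⊕ʷ ψ v′
  binomial-with-LM-first i w v {m} g≈w-v m-LM
    with binom-support w v m (λ w-v≈0 → proj₁ m-LM (≈-trans (g≈w-v m) w-v≈0))
  ... | inj₁ refl = v , g≈w-v , refl
  ... | inj₂ refl = w , (λ z → ≈-trans (g≈w-v z) (binom-comm -1≈1 w v z)) , ⊕ʷ-comm (ψ w) (ψ v)
    where
    w≢v : w ≢ v
    w≢v refl = proj₁ m-LM (≈-trans (g≈w-v w) (binom-self w w))
    -1≈1 : - 1# ≈ 1#
    -1≈1 = ≈-trans (≈-sym (coeff-binomʳ w≢v)) (≈-trans (≈-sym (g≈w-v v)) (monic i v m-LM))

  deg-LM≡tPrime⊎suc : ∀ i → (∀ k → ¬ (lookup G i ≈ₚ binom (var k ·ₘ var k) oneₘ)) →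
                      ∀ w v {m} → lookup G i ≈ₚ binom w v → IsLM _<_ (lookup G i) m →
                      deg m ≡ tPrime (weight (ψ w ⊕ʷ ψ v)) ⊎
                      deg m ≡ suc (tPrime (weight (ψ w ⊕ʷ ψ v)))
  deg-LM≡tPrime⊎suc i g≉x²-1 w v g≈w-v m-LM with binomial-with-LM-first i w v g≈w-v m-LM
  ... | v′ , g≈m-v′ , ψw⊕ψv≡ψm⊕ψv′ rewrite ψw⊕ψv≡ψm⊕ψv′ =
    LeadingTerm.deg-LM≡tPrime⊎suc i g≈m-v′ m-LM g≉x²-1

proposition1 : ∀ {c ℓ : Level} (F : Field c ℓ) (n : ℕ)
    (C : Word n → Set) → IsBinaryLinearCode C →
    (_<_ : Rel (Monomial n) 0ℓ) → IsTermOrder _<_ → IsDegCompatible _<_ →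
    (∀ i j → i Fin.< j → var i < var j) →
    let open Polynomials F n in
    (G : List Poly) → IsReducedGB _<_ I[ C ] G →
    (i : Fin (length G)) →
    (∀ k → ¬ (lookup G i ≈ₚ binom (var k ·ₘ var k) oneₘ)) →
    ∀ w v → lookup G i ≈ₚ binom w v →
    ∀ m → IsLM _<_ (lookup G i) m →
    deg m ≡ tPrime (weight (ψ w ⊕ʷ ψ v)) ⊎ deg m ≡ suc (tPrime (weight (ψ w ⊕ʷ ψ v)))
proposition1 F n C C-linear _<_ <-termOrder <-degCompatible _ G G-reducedGB
             i g≉x²-1 w v g≈w-v m m-LM =
  ReducedGroebnerBasisOfCode.deg-LM≡tPrime⊎suc
    F C C-linear _<_ <-termOrder <-degCompatible G G-reducedGB i g≉x²-1 w v g≈w-v m-LM
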